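{- In every $\omega$-category $(C,\odot_i,s_i,t_i)_{0\le i<\omega}$, for all $0\le i<j<\omega$ and all $x,y\in C$: $s_j(x\odot_i y)=s_j(x)\odot_i s_j(y)$ and $t_j(x\odot_i y)=t_j(x)\odot_i t_j(y)$.
   Context: A catoid $(C,\odot,s,t)$ is a set with $\odot:C\times C\to\mathcal P C$ and $s,t:C\to C$ such that, with $X\odot Y=\bigcup_{x\in X,y\in Y}x\odot y$: $x\odot(y\odot z)=(x\odot y)\odot z$, $x\odot y\ne\emptyset\Rightarrow t(x)=s(y)$, $s(x)\odot x=\{x\}$, $x\odot t(x)=\{x\}$; local if $t(x)=s(y)\Rightarrow x\odot y\ne\emptyset$; functional if $x,x'\in y\odot z\Rightarrow x=x'$. Direct images under $s,t$ are written $s(X),t(X)$. An $\omega$-catoid is a family of catoids $(C,\odot_i,s_i,t_i)_{0\le i<\omega}$ on one set with, for $i\ne j$: $s_is_j=s_js_i$, $s_it_j=t_js_i$, $t_it_j=t_jt_i$, $s_i(x\odot_j y)\subseteq s_i(x)\odot_j s_i(y)$, $t_i(x\odot_j y)\subseteq t_i(x)\odot_j t_i(y)$; for $i<j$: $(w\odot_jx)\odot_i(y\odot_jz)\subseteq(w\odot_iy)\odot_j(x\odot_iz)$, $s_js_i=s_i$, $s_jt_i=t_i$, $t_js_i=s_i$, $t_jt_i=t_i$. An $\omega$-category is an $\omega$-catoid in which each component catoid is local and functional. -}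

module Defs where

open import Level using (Level; suc)
open import Data.Nat using (ℕ; _<_)
open import Data.Product using (∃; _×_; _,_)
open import Relation.Binary.PropositionalEquality using (_≡_)
open import Relation.Nullary using (¬_)

Pow : ∀ {a} → Set a → Set (suc a)
Pow {a} C = C → Set a

module _ {a : Level} {C : Set a} where

  _⊆_ : Pow C → Pow C → Set a
  X ⊆ Y = ∀ z → X z → Y z

  _≐_ : Pow C → Pow C → Set a
  X ≐ Y = (X ⊆ Y) × (Y ⊆ X)

  ∅≢ : Pow C → Set a
  ∅≢ X = ∃ λ z → X z

  ｛_｝ : C → Pow C
  ｛ x ｝ z = z ≡ x

  image : (C → C) → Pow C → Pow C
  image f X z = ∃ λ x → X x × (z ≡ f x)

  liftP : (C → C → Pow C) → Pow C → Pow C → Pow C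
  liftP _⊙_ X Y z = ∃ λ x → ∃ λ y → X x × Y y × (x ⊙ y) z

  ⊙-left : (C → C → Pow C) → C → C → C → Pow C
  ⊙-left _⊙_ x y z = liftP _⊙_ ｛ x ｝ (y ⊙ z)

  ⊙-right : (C → C → Pow C) → C → C → C → Pow C
  ⊙-right _⊙_ x y z = liftP _⊙_ (x ⊙ y) ｛ z ｝

-- Catoid (C, ⊙, s, t); z ∈ x ⊙ y is written (x ⊙ y) z.
record IsCatoid {a} {C : Set a} (_⊙_ : C → C → Pow C) (s t : C → C) : Set (suc a) where
  field
    assoc  : ∀ x y z → ⊙-left _⊙_ x y z ≐ ⊙-right _⊙_ x y z
    ne⇒ts  : ∀ x y → ∅≢ (x ⊙ y) → t x ≡ s y
    s-unit : ∀ x → (s x ⊙ x) ≐ ｛ x ｝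
    t-unit : ∀ x → (x ⊙ t x) ≐ ｛ x ｝

IsLocal : ∀ {a} {C : Set a} → (C → C → Pow C) → (C → C) → (C → C) → Set a
IsLocal _⊙_ s t = ∀ x y → t x ≡ s y → ∅≢ (x ⊙ y)

IsFunctional : ∀ {a} {C : Set a} → (C → C → Pow C) → Set a
IsFunctional _⊙_ = ∀ x x' y z → (y ⊙ z) x → (y ⊙ z) x' → x ≡ x'

record IsωCatoid {a} {C : Set a} (⊙ : ℕ → C → C → Pow C) (s t : ℕ → C → C)
       : Set (suc a) where
  field
    catoid : ∀ i → IsCatoid (⊙ i) (s i) (t i)
    ss-comm : ∀ i j → ¬ i ≡ j → ∀ x → s i (s j x) ≡ s j (s i x)
    st-comm : ∀ i j → ¬ i ≡ j → ∀ x → s i (t j x) ≡ t j (s i x)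
    tt-comm : ∀ i j → ¬ i ≡ j → ∀ x → t i (t j x) ≡ t j (t i x)
    s-⊙ : ∀ i j → ¬ i ≡ j → ∀ x y →
          image (s i) (⊙ j x y) ⊆ ⊙ j (s i x) (s i y)
    t-⊙ : ∀ i j → ¬ i ≡ j → ∀ x y →
          image (t i) (⊙ j x y) ⊆ ⊙ j (t i x) (t i y)
    interchange : ∀ i j → i < j → ∀ w x y z →
          liftP (⊙ i) (⊙ j w x) (⊙ j y z) ⊆ liftP (⊙ j) (⊙ i w y) (⊙ i x z)
    sj-si : ∀ i j → i < j → ∀ x → s j (s i x) ≡ s i x
    sj-ti : ∀ i j → i < j → ∀ x → s j (t i x) ≡ t i x
    tj-si : ∀ i j → i < j → ∀ x → t j (s i x) ≡ s i x
    tj-ti : ∀ i j → i < j → ∀ x → t j (t i x) ≡ t i x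

record IsωCategory {a} {C : Set a} (⊙ : ℕ → C → C → Pow C) (s t : ℕ → C → C)
       : Set (suc a) where
  field
    isωCatoid  : IsωCatoid ⊙ s t
    local      : ∀ i → IsLocal (⊙ i) (s i) (t i)
    functional : ∀ i → IsFunctional (⊙ i)

{-# OPTIONS --safe #-}
module Submission where

open import Defs
open import Level using (Level)
open import Data.Nat using (ℕ; _<_)
open import Data.Nat.Properties using (<⇒≢)
open import Data.Product using (_×_; _,_)
open import Function using (_∘′_)
open import Relation.Nullary using (¬_)
open import Relation.Binary.PropositionalEquality using (_≡_; refl; sym; trans; _≗_)

-- If f x ⊙ f y is nonempty, so is x ⊙ y (f preserves boundaries, and locality);
-- any of its elements w gives f w ∈ f x ⊙ f y, which by functionality is the only element.
module _ {a} {C : Set a} {_⊙_ : C → C → Pow C} {s t : C → C}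
         (catoid : IsCatoid _⊙_ s t) (local : IsLocal _⊙_ s t)
         (functional : IsFunctional _⊙_) where

  open IsCatoid catoid using (ne⇒ts)

  image-⊙-≐ : (f : C → C) → t ∘′ f ≗ t → s ∘′ f ≗ s →
              (∀ x y → image f (x ⊙ y) ⊆ (f x ⊙ f y)) →
              ∀ x y → image f (x ⊙ y) ≐ (f x ⊙ f y)
  image-⊙-≐ f t∘f≗t s∘f≗s lax x y = lax x y , image-⊇
    where
    image-⊇ : (f x ⊙ f y) ⊆ image f (x ⊙ y)
    image-⊇ z z∈fx⊙fy with local x y (trans (sym (t∘f≗t x))
                             (trans (ne⇒ts (f x) (f y) (z , z∈fx⊙fy)) (s∘f≗s y)))
    ... | w , w∈x⊙y = w , w∈x⊙y ,
      functional z (f w) (f x) (f y) z∈fx⊙fy (lax x y (f w) (w , w∈x⊙y , refl))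

module _ {a} {C : Set a} {⊙ : ℕ → C → C → Pow C} {s t : ℕ → C → C}
         (ωcatoid : IsωCatoid ⊙ s t) {i j : ℕ} (i<j : i < j) where

  open IsωCatoid ωcatoid

  private
    i≢j : ¬ i ≡ j
    i≢j = <⇒≢ i<j

    j≢i : ¬ j ≡ i
    j≢i j≡i = <⇒≢ i<j (sym j≡i)

  sᵢ∘sⱼ≗sᵢ : s i ∘′ s j ≗ s i
  sᵢ∘sⱼ≗sᵢ x = trans (ss-comm i j i≢j x) (sj-si i j i<j x)

  tᵢ∘sⱼ≗tᵢ : t i ∘′ s j ≗ t i
  tᵢ∘sⱼ≗tᵢ x = trans (sym (st-comm j i j≢i x)) (sj-ti i j i<j x)

  sᵢ∘tⱼ≗sᵢ : s i ∘′ t j ≗ s i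
  sᵢ∘tⱼ≗sᵢ x = trans (st-comm i j i≢j x) (tj-si i j i<j x)

  tᵢ∘tⱼ≗tᵢ : t i ∘′ t j ≗ t i
  tᵢ∘tⱼ≗tᵢ x = trans (tt-comm i j i≢j x) (tj-ti i j i<j x)

  sⱼ-⊙ᵢ : ∀ x y → image (s j) (⊙ i x y) ⊆ ⊙ i (s j x) (s j y)
  sⱼ-⊙ᵢ = s-⊙ j i j≢i

  tⱼ-⊙ᵢ : ∀ x y → image (t j) (⊙ i x y) ⊆ ⊙ i (t j x) (t j y)
  tⱼ-⊙ᵢ = t-⊙ j i j≢i

lemma6p3 : ∀ {a : Level} {C : Set a} (⊙ : ℕ → C → C → Pow C) (s t : ℕ → C → C) →
    IsωCategory ⊙ s t →
    ∀ i j → i < j → ∀ x y →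
      (image (s j) (⊙ i x y) ≐ ⊙ i (s j x) (s j y)) ×
      (image (t j) (⊙ i x y) ≐ ⊙ i (t j x) (t j y))
lemma6p3 ⊙ s t cat i j i<j x y =
    image-⊙-≐ (catoid i) (local i) (functional i) (s j)
      (tᵢ∘sⱼ≗tᵢ ωcatoid i<j) (sᵢ∘sⱼ≗sᵢ ωcatoid i<j) (sⱼ-⊙ᵢ ωcatoid i<j) x y
  , image-⊙-≐ (catoid i) (local i) (functional i) (t j)
      (tᵢ∘tⱼ≗tᵢ ωcatoid i<j) (sᵢ∘tⱼ≗sᵢ ωcatoid i<j) (tⱼ-⊙ᵢ ωcatoid i<j) x y
  where
  open IsωCategory cat renaming (isωCatoid to ωcatoid)
  open IsωCatoid ωcatoid using (catoid)
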